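{- If the $K$-formula $J=\{C_1,\dots,C_m\}$ over $n$ variables is $(t,\tau)$-pseudo-random, then for every $\psi\in\{\pm 1\}^n$ the distribution $\mathcal D(J,\psi)$ is $(t,n^t\tau)$-close to the uniform distribution.
   Context: A $K$-tuple is a map $C:\{\pm1\}^n\to\{\pm1\}^K$, $C(\psi)=(\sigma_1\psi_{i_1},\dots,\sigma_K\psi_{i_K})$ with distinct $i_1,\dots,i_K\in[n]$ and signs $\sigma_j\in\{\pm1\}$; a $K$-formula is a collection $J=\{C_1,\dots,C_m\}$ of $K$-tuples. For $A\subset[K]$, a partial $K$-tuple supported in $A$ is a map $C:\{\pm1\}^n\to\{ -1,1,*\}^K$ whose coordinates in $A$ are literals on $|A|$ distinct variables and whose other coordinates are the constant $*$; its size is $|A|$. $\Pi_A:\{\pm1\}^K\to\{ -1,1,*\}^K$ replaces coordinates outside $A$ by $*$; $C_A=\Pi_A\circ C$. $\mathrm{Fr}_J(C)=\frac{|\{j:(C_j)_A=C\}|}{m}$ for $C$ supported in $A$. $p_{n,t}=\frac{1}{(2n)(2n-2)\cdots(2n-2t+2)}$. $J$ is $(t,\tau)$-pseudo-random if $|\mathrm{Fr}_J(C)-p_{n,t'}|<\tau$ for every partial $K$-tuple $C$ of size $t'\le t$. $\mathcal D(J,\psi)$ is the distribution of $C_j(\psi)\in\{\pm1\}^K$ for $j$ uniform in $[m]$. A vector $z\in\{ -1,1,*\}^K$ is supported in $A=\{i:z_i\ne*\}$. A distribution $\mathcal D$ on $\{\pm1\}^K$ is $(t,\mu)$-close to uniform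 if for every $A\subset[K]$ with $|A|\le t$ and every $z\in\{ -1,1,*\}^K$ supported in $A$, $\left|\Pr_{z'\sim\mathcal D}(\Pi_A(z')=z)-2^{ -|A|}\right|\le\mu$. -}

module Defs where

import Data.Nat as ℕ
open ℕ using (ℕ; zero; suc; _∸_)
open import Data.Integer as ℤ using (ℤ)
open import Data.Rational as ℚ using (ℚ)
open import Data.Fin as Fin using (Fin)
open import Data.Fin.Properties using (all?)
open import Data.Bool using (Bool; true; false; if_then_else_)
open import Data.Maybe using (Maybe; just; nothing; is-just)
open import Data.Product using (_×_; _,_)
open import Relation.Binary.PropositionalEquality using (_≡_; refl; cong₂)
open import Relation.Binary.Definitions using (DecidableEquality)
open import Relation.Nullary using (yes; no; does)
open import Function.Definitions using (Injective)

data Pm : Set where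
  pos neg : Pm

_·_ : Pm → Pm → Pm
pos · s = s
neg · pos = neg
neg · neg = pos

_≟Pm_ : DecidableEquality Pm
pos ≟Pm pos = yes refl
pos ≟Pm neg = no λ ()
neg ≟Pm pos = no λ ()
neg ≟Pm neg = yes refl

-- assignments ψ ∈ {±1}^n, vectors in {±1}^K and {neg,1,*}^K (nothing = *)
Assignment : ℕ → Set
Assignment n = Fin n → Pm

Star : ℕ → Set
Star K = Fin K → Maybe Pm

count : ∀ {m} → (Fin m → Bool) → ℕ
count {zero}  f = 0
count {suc m} f = (if f Fin.zero then 1 else 0) ℕ.+ count (λ i → f (Fin.suc i))

-- a / d as a rational; only ever used with d ≠ 0 (d = 0 ↦ 0 by convention)
frac : ℕ → ℕ → ℚ
frac a zero    = ℚ.0ℚ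
frac a (suc d) = ℤ.+ a ℚ./ suc d

fromℕ : ℕ → ℚ
fromℕ a = ℤ.+ a ℚ./ 1

fallProd : ℕ → ℕ → ℕ
fallProd n zero    = 1
fallProd n (suc t) = fallProd n t ℕ.* (2 ℕ.* n ∸ 2 ℕ.* t)

p : ℕ → ℕ → ℚ
p n t = frac 1 (fallProd n t)

record KTuple (n K : ℕ) : Set where
  field
    var     : Fin K → Fin n
    var-inj : Injective _≡_ _≡_ var
    sgn     : Fin K → Pm
open KTuple public

apply : ∀ {n K} → KTuple n K → Assignment n → Fin K → Pm
apply C ψ k = sgn C k · ψ (var C k)

-- A K-formula J = {C_1,…,C_m} with m ≥ 1 (indexed by Fin (suc m'))
Formula : ℕ → ℕ → ℕ → Set
Formula m n K = Fin (suc m) → KTuple n K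

-- Partial K-tuples: coordinate k is either * (nothing) or the literal
-- σ ψ_i, represented by just (i , σ); the variables of the non-* coordinates
-- are distinct.

Lit : ℕ → Set
Lit n = Fin n × Pm

_≟Lit_ : ∀ {n} → DecidableEquality (Maybe (Lit n))
nothing ≟Lit nothing = yes refl
nothing ≟Lit just _ = no λ ()
just _ ≟Lit nothing = no λ ()
just (i , s) ≟Lit just (j , r) with i Fin.≟ j | s ≟Pm r
... | yes refl | yes refl = yes refl
... | no ne    | _        = no λ { refl → ne refl }
... | yes _    | no ne    = no λ { refl → ne refl }

record PartialTuple (n K : ℕ) : Set where
  field
    lit      : Fin K → Maybe (Lit n)
    lit-inj  : ∀ k l i j s r → lit k ≡ just (i , s) → lit l ≡ just (j , r) →
               i ≡ j → k ≡ l
open PartialTuple public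

supportP : ∀ {n K} → PartialTuple n K → Fin K → Bool
supportP P k = is-just (lit P k)

sizeP : ∀ {n K} → PartialTuple n K → ℕ
sizeP P = count (supportP P)

restrict : ∀ {n K} → (Fin K → Bool) → KTuple n K → Fin K → Maybe (Lit n)
restrict A C k = if A k then just (var C k , sgn C k) else nothing

Fr : ∀ {m n K} → Formula m n K → PartialTuple n K → ℚ
Fr {m} J P =
  frac (count (λ j → does (all? (λ k → restrict (supportP P) (J j) k ≟Lit lit P k))))
       (suc m)

PseudoRandom : ∀ {m n K} → ℕ → ℚ → Formula m n K → Set
PseudoRandom {n = n} t τ J =
  ∀ (P : PartialTuple n _) → sizeP P ℕ.≤ t → ℚ.∣ Fr J P ℚ.- p n (sizeP P) ∣ ℚ.< τ

-- Distributions on {±1}^K given as the law of x_j for j uniform in Fin (suc m)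

EmpiricalDist : ℕ → ℕ → Set
EmpiricalDist m K = Fin (suc m) → (Fin K → Pm)

supportZ : ∀ {K} → Star K → Fin K → Bool
supportZ z k = is-just (z k)

sizeZ : ∀ {K} → Star K → ℕ
sizeZ z = count (supportZ z)

Π : ∀ {K} → (Fin K → Bool) → (Fin K → Pm) → Star K
Π A x k = if A k then just (x k) else nothing

_≟Star_ : DecidableEquality (Maybe Pm)
nothing ≟Star nothing = yes refl
nothing ≟Star just _ = no λ ()
just _ ≟Star nothing = no λ ()
just s ≟Star just r with s ≟Pm r
... | yes refl = yes refl
... | no ne    = no λ { refl → ne refl }

Prob : ∀ {m K} → EmpiricalDist m K → Star K → ℚ
Prob {m} D z =
  frac (count (λ j → does (all? (λ k → Π (supportZ z) (D j) k ≟Star z k)))) (suc m)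

CloseToUniform : ∀ {m K} → ℕ → ℚ → EmpiricalDist m K → Set
CloseToUniform {K = K} t μ D =
  ∀ (z : Star K) → sizeZ z ℕ.≤ t →
    ℚ.∣ Prob D z ℚ.- frac 1 (2 ℕ.^ sizeZ z) ∣ ℚ.≤ μ

𝒟 : ∀ {m n K} → Formula m n K → Assignment n → EmpiricalDist m K
𝒟 J ψ j = apply (J j) ψ

-- Fix z with support A of size s ≥ 1.  The sample C_j(ψ) agrees with z on A exactly when
-- (C_j)_A is the partial tuple P_g whose variables are g = var (C_j) restricted to A and whose
-- signs are z_k ψ_(g k); g is an injection A → [n] determined by C_j.  Hence
-- Pr(Π_A z' = z) = Σ_g Fr_J(P_g), summed over the n (n-1) ⋯ (n-s+1) injections, while
-- 2^-s = Σ_g p_(n,s) because p_(n,s) = 1 / (2^s n (n-1) ⋯ (n-s+1)).  Each of these at most n^t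
-- terms differs by less than τ.  For s = 0 both sides equal 1.

module Submission where

open import Defs
open import Data.Nat using (ℕ; _^_)
open import Data.Rational using (ℚ; _*_)

open import Algebra.Properties.CommutativeSemigroup using (interchange)
open import Data.Bool using (Bool; true; false; _∧_; if_then_else_)
open import Data.Fin as Fin using (Fin; zero; suc; punchIn; punchOut)
open import Data.Fin.Properties
  using ( all?; 0≢1+n; suc-injective; punchInᵢ≢i; punchIn-injective
        ; punchIn-punchOut; punchOut-punchIn; punchOut-cong )
import Data.Integer as ℤ
import Data.Integer.Properties as ℤₚ
import Data.Integer.Solver as ℤ-Solver
open import Data.List as List using (List; []; _∷_; _++_; length; concat; tabulate)
open import Data.List.Properties using (length-++; length-map; map-++; map-cong)
open import Data.Maybe as Maybe using (Maybe; just; nothing; is-just)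
open import Data.Maybe.Properties using (≡-dec; just-injective)
open import Data.Nat as ℕ using (zero; suc; _+_; _∸_; _≤_; _<_; z≤n; s≤s)
open import Data.Nat.Combinatorics.Base using (_P′_)
open import Data.Nat.ListAction using (sum)
open import Data.Nat.ListAction.Properties using (sum-++)
import Data.Nat.Properties as ℕₚ
import Data.Nat.Solver as ℕ-Solver
open import Data.Product using (_×_; _,_; proj₁; proj₂; ∃)
import Data.Rational as ℚ
import Data.Rational.Properties as ℚₚ
import Data.Rational.Solver as ℚ-Solver
open import Data.Rational.Unnormalised as ℚᵘ using (mkℚᵘ; *≡*)
import Data.Rational.Unnormalised.Properties as ℚᵘₚ
open import Data.Vec.Functional using (tail)
open import Function using (_∘_; _⇔_; mk⇔; Equivalence)
open import Relation.Binary.PropositionalEquality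
open import Relation.Nullary using (Dec; does; yes; no; ¬_; contradiction; _×-dec_)
open import Relation.Nullary.Decidable using (does-⇔; dec-true; dec-false)

𝟙 : Bool → ℕ
𝟙 b = if b then 1 else 0

module _ {A : Set} where

  sum-map-zero : ∀ {f : A → ℕ} xs → (∀ x → f x ≡ 0) → sum (List.map f xs) ≡ 0
  sum-map-zero []       f≡0 = refl
  sum-map-zero (x ∷ xs) f≡0 = cong₂ _+_ (f≡0 x) (sum-map-zero xs f≡0)

  sum-map-+ : ∀ (f g : A → ℕ) xs →
    sum (List.map (λ x → f x + g x) xs) ≡ sum (List.map f xs) + sum (List.map g xs)
  sum-map-+ f g []       = refl
  sum-map-+ f g (x ∷ xs) =
    trans (cong (f x + g x +_) (sum-map-+ f g xs))
          (interchange ℕₚ.+-commutativeSemigroup (f x) (g x) _ _)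

  sum-map-𝟙-∧ : ∀ b (e : A → Bool) xs →
    sum (List.map (λ x → 𝟙 (b ∧ e x)) xs) ≡ 𝟙 b ℕ.* sum (List.map (𝟙 ∘ e) xs)
  sum-map-𝟙-∧ true  e xs = sym (ℕₚ.+-identityʳ _)
  sum-map-𝟙-∧ false e xs = sum-map-zero xs (λ _ → refl)

count-cong : ∀ {m} {f g : Fin m → Bool} → (∀ j → f j ≡ g j) → count f ≡ count g
count-cong {zero}  f≗g = refl
count-cong {suc m} f≗g = cong₂ _+_ (cong 𝟙 (f≗g zero)) (count-cong (f≗g ∘ suc))

count-const : ∀ m b → count {m} (λ _ → b) ≡ m ℕ.* 𝟙 b
count-const zero    b = refl
count-const (suc m) b = cong (𝟙 b +_) (count-const m b)

count≡0⇒false : ∀ {m} (f : Fin m → Bool) → count f ≡ 0 → ∀ j → f j ≡ false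
count≡0⇒false f c≡0 zero    = 𝟙≡0 (f zero) (ℕₚ.m+n≡0⇒m≡0 _ c≡0)
  where
  𝟙≡0 : ∀ b → 𝟙 b ≡ 0 → b ≡ false
  𝟙≡0 false _ = refl
count≡0⇒false f c≡0 (suc j) = count≡0⇒false (f ∘ suc) (ℕₚ.m+n≡0⇒n≡0 _ c≡0) j

count-sum : ∀ {m} {A : Set} (a : Fin m → Bool) (b : A → Fin m → Bool) xs →
  (∀ j → 𝟙 (a j) ≡ sum (List.map (λ x → 𝟙 (b x j)) xs)) →
  count a ≡ sum (List.map (λ x → count (b x)) xs)
count-sum {zero}  a b xs _ = sym (sum-map-zero xs (λ _ → refl))
count-sum {suc m} a b xs a≡∑b = begin
  𝟙 (a zero) + count (a ∘ suc)
    ≡⟨ cong₂ _+_ (a≡∑b zero) (count-sum (a ∘ suc) (λ x → b x ∘ suc) xs (a≡∑b ∘ suc)) ⟩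
  sum (List.map (λ x → 𝟙 (b x zero)) xs) + sum (List.map (λ x → count (b x ∘ suc)) xs)
    ≡⟨ sum-map-+ _ _ xs ⟨
  sum (List.map (λ x → count (b x)) xs) ∎
  where open ≡-Reasoning

record PartialInjection {K : ℕ} (A : Fin K → Bool) (n : ℕ) : Set where
  field
    fun       : Fin K → Maybe (Fin n)
    domain    : ∀ k → is-just (fun k) ≡ A k
    injective : ∀ {k l i} → fun k ≡ just i → fun l ≡ just i → k ≡ l
open PartialInjection

module _ {K n : ℕ} {A : Fin K → Bool} where

  infix 4 _≐_ _≐?_

  _≐_ : PartialInjection A n → PartialInjection A n → Set
  g ≐ f = ∀ k → fun g k ≡ fun f k

  _≐?_ : ∀ g f → Dec (g ≐ f)
  g ≐? f = all? λ k → ≡-dec Fin._≟_ (fun g k) (fun f k)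

  multiplicity : List (PartialInjection A n) → PartialInjection A n → ℕ
  multiplicity gs f = sum (List.map (λ g → 𝟙 (does (g ≐? f))) gs)

  multiplicity≤length : ∀ gs f → multiplicity gs f ≤ length gs
  multiplicity≤length []       f = z≤n
  multiplicity≤length (g ∷ gs) f with does (g ≐? f)
  ... | true  = s≤s (multiplicity≤length gs f)
  ... | false = ℕₚ.m≤n⇒m≤1+n (multiplicity≤length gs f)

  multiplicity-++ : ∀ gs hs f → multiplicity (gs ++ hs) f ≡ multiplicity gs f + multiplicity hs f
  multiplicity-++ gs hs f =
    trans (cong sum (map-++ ind gs hs)) (sum-++ (List.map ind gs) (List.map ind hs))
    where ind = λ g → 𝟙 (does (g ≐? f))

  multiplicity-concat-tabulate : ∀ {N} (F : Fin N → List (PartialInjection A n)) i f →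
    (∀ j → j ≢ i → multiplicity (F j) f ≡ 0) →
    multiplicity (concat (tabulate F)) f ≡ multiplicity (F i) f
  multiplicity-concat-tabulate {suc N} F i f others≡0 =
    trans (multiplicity-++ (F zero) _ f) (split i others≡0)
    where
    rest≡0 : ∀ {N} (F : Fin N → List (PartialInjection A n)) →
      (∀ j → multiplicity (F j) f ≡ 0) → multiplicity (concat (tabulate F)) f ≡ 0
    rest≡0 {zero}  F F≡0 = refl
    rest≡0 {suc N} F F≡0 =
      trans (multiplicity-++ (F zero) _ f) (cong₂ _+_ (F≡0 zero) (rest≡0 (F ∘ suc) (F≡0 ∘ suc)))
    split : ∀ i → (∀ j → j ≢ i → multiplicity (F j) f ≡ 0) →
      multiplicity (F zero) f + multiplicity (concat (tabulate (F ∘ suc))) f ≡ multiplicity (F i) f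
    split zero    others≡0 =
      trans (cong (multiplicity (F zero) f +_) (rest≡0 (F ∘ suc) (λ j → others≡0 (suc j) (λ ()))))
            (ℕₚ.+-identityʳ _)
    split (suc i) others≡0 =
      cong₂ _+_ (others≡0 zero (λ ()))
        (multiplicity-concat-tabulate (F ∘ suc) i f
          (λ j j≢i → others≡0 (suc j) (j≢i ∘ suc-injective)))

module _ {K K′ n n′ : ℕ} {A : Fin K → Bool} {A′ : Fin K′ → Bool}
         (h : PartialInjection A n → PartialInjection A′ n′) where

  multiplicity-map : ∀ {f f′} gs → (∀ g → h g ≐ f ⇔ g ≐ f′) →
    multiplicity (List.map h gs) f ≡ multiplicity gs f′
  multiplicity-map           []       h≐⇔ = refl
  multiplicity-map {f} {f′} (g ∷ gs) h≐⇔ =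
    cong₂ _+_ (cong 𝟙 (does-⇔ (h≐⇔ g) (h g ≐? f) (g ≐? f′)))
              (multiplicity-map {f} {f′} gs h≐⇔)

  multiplicity-map-none : ∀ {f} gs → (∀ g → ¬ h g ≐ f) → multiplicity (List.map h gs) f ≡ 0
  multiplicity-map-none       []       h≭ = refl
  multiplicity-map-none {f} (g ∷ gs) h≭ =
    cong₂ _+_ (cong 𝟙 (dec-false (h g ≐? f) (h≭ g))) (multiplicity-map-none {f} gs h≭)

is-just-map : ∀ {X Y : Set} (f : X → Y) x → is-just (Maybe.map f x) ≡ is-just x
is-just-map f nothing  = refl
is-just-map f (just _) = refl

map-punchIn≡just : ∀ {n} {i : Fin (suc n)} {j} x → Maybe.map (punchIn i) x ≡ just j →
  ∃ λ y → x ≡ just y × punchIn i y ≡ j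
map-punchIn≡just (just y) refl = y , refl , refl

punchOutᴹ : ∀ {n} → Fin (suc n) → Maybe (Fin (suc n)) → Maybe (Fin n)
punchOutᴹ i nothing = nothing
punchOutᴹ i (just j) with i Fin.≟ j
... | yes _   = nothing
... | no  i≢j = just (punchOut i≢j)

map-punchIn-punchOutᴹ : ∀ {n} (i : Fin (suc n)) y → y ≢ just i →
  Maybe.map (punchIn i) (punchOutᴹ i y) ≡ y
map-punchIn-punchOutᴹ i nothing  _ = refl
map-punchIn-punchOutᴹ i (just j) y≢i with i Fin.≟ j
... | yes refl = contradiction refl y≢i
... | no  i≢j  = cong just (punchIn-punchOut i≢j)

punchOutᴹ-map-punchIn : ∀ {n} (i : Fin (suc n)) x → punchOutᴹ i (Maybe.map (punchIn i) x) ≡ x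
punchOutᴹ-map-punchIn i nothing  = refl
punchOutᴹ-map-punchIn i (just x) with i Fin.≟ punchIn i x
... | yes i≡ = contradiction (sym i≡) (punchInᵢ≢i i x)
... | no  i≢ = cong just (trans (punchOut-cong i refl) (punchOut-punchIn i))

empty : ∀ {n} {A : Fin 0 → Bool} → PartialInjection A n
empty = record { fun = λ () ; domain = λ () ; injective = λ { {()} } }

[1+n]P′[1+k]≡[1+n]*nP′k : ∀ n k → suc n P′ suc k ≡ suc n ℕ.* (n P′ k)
[1+n]P′[1+k]≡[1+n]*nP′k n zero    = refl
[1+n]P′[1+k]≡[1+n]*nP′k n (suc k) rewrite [1+n]P′[1+k]≡[1+n]*nP′k n k =
  solve 3 (λ d m P → d :* (m :* P) := m :* (d :* P)) refl (n ∸ k) (suc n) (n P′ k)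
  where open ℕ-Solver.+-*-Solver

length-concat-tabulate : ∀ {X : Set} {N c} (F : Fin N → List X) →
  (∀ i → length (F i) ≡ c) → length (concat (tabulate F)) ≡ N ℕ.* c
length-concat-tabulate {N = zero}  F _        = refl
length-concat-tabulate {N = suc N} F length≡c =
  trans (length-++ (F zero))
        (cong₂ _+_ (length≡c zero) (length-concat-tabulate (F ∘ suc) (length≡c ∘ suc)))

module _ {K : ℕ} {A : Fin (suc K) → Bool} where

  head-nothing : ∀ {n} (f : PartialInjection A n) → A zero ≡ false → fun f zero ≡ nothing
  head-nothing f A₀ with fun f zero | domain f zero
  ... | nothing | _   = refl
  ... | just _  | f∈A = contradiction (trans f∈A A₀) λ ()

  head-just : ∀ {n} (f : PartialInjection A n) → A zero ≡ true → ∃ λ i → fun f zero ≡ just i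
  head-just f A₀ with fun f zero | domain f zero
  ... | just i  | _   = i , refl
  ... | nothing | f∉A = contradiction (trans f∉A A₀) λ ()

  skip : ∀ {n} → A zero ≡ false → PartialInjection (tail A) n → PartialInjection A n
  skip A₀ g = record
    { fun       = λ { zero → nothing ; (suc k) → fun g k }
    ; domain    = λ { zero → sym A₀ ; (suc k) → domain g k }
    ; injective = λ { {zero} {zero} _ _ → refl
                    ; {suc k} {suc l} e e′ → cong suc (injective g e e′)
                    ; {zero} {suc _} () _
                    ; {suc _} {zero} _ () } }

  unskip : ∀ {n} → PartialInjection A n → PartialInjection (tail A) n
  unskip f = record
    { fun       = fun f ∘ suc
    ; domain    = domain f ∘ suc
    ; injective = λ e e′ → suc-injective (injective f e e′) }

  skip≐⇔≐unskip : ∀ {n} (A₀ : A zero ≡ false) (f : PartialInjection A n) →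
    ∀ g → skip A₀ g ≐ f ⇔ g ≐ unskip f
  skip≐⇔≐unskip A₀ f g =
    mk⇔ (λ g≐ k → g≐ (suc k))
        (λ { g≐ zero → sym (head-nothing f A₀) ; g≐ (suc k) → g≐ k })

  extend : ∀ {n} → A zero ≡ true → Fin (suc n) →
    PartialInjection (tail A) n → PartialInjection A (suc n)
  extend A₀ i g = record
    { fun       = λ { zero → just i ; (suc k) → Maybe.map (punchIn i) (fun g k) }
    ; domain    = λ { zero → sym A₀ ; (suc k) → trans (is-just-map (punchIn i) (fun g k)) (domain g k) }
    ; injective = λ { {zero} {zero} _ _ → refl
                    ; {zero} {suc l} refl e′ → contradiction e′ (missesᵢ l)
                    ; {suc k} {zero} e refl → contradiction e (missesᵢ k)
                    ; {suc k} {suc l} e e′ → cong suc (injective-tail e e′) } }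
    where
    missesᵢ : ∀ k → Maybe.map (punchIn i) (fun g k) ≢ just i
    missesᵢ k e with map-punchIn≡just (fun g k) e
    ... | y , _ , punchIn≡i = punchInᵢ≢i i y punchIn≡i
    injective-tail : ∀ {k l j} → Maybe.map (punchIn i) (fun g k) ≡ just j →
      Maybe.map (punchIn i) (fun g l) ≡ just j → k ≡ l
    injective-tail {k} {l} e e′ with map-punchIn≡just (fun g k) e | map-punchIn≡just (fun g l) e′
    ... | y , gk≡y , refl | y′ , gl≡y′ , ↑y≡↑y′ =
      injective g gk≡y (trans gl≡y′ (cong just (sym (punchIn-injective i y y′ (sym ↑y≡↑y′)))))

  unextend : ∀ {n} (f : PartialInjection A (suc n)) {i} → fun f zero ≡ just i →
    PartialInjection (tail A) n
  unextend f {i} f₀ = record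
    { fun       = λ k → punchOutᴹ i (fun f (suc k))
    ; domain    = λ k → begin
        is-just (punchOutᴹ i (fun f (suc k)))                      ≡⟨ is-just-map (punchIn i) _ ⟨
        is-just (Maybe.map (punchIn i) (punchOutᴹ i (fun f (suc k)))) ≡⟨ cong is-just (map-punchIn-punchOutᴹ i _ (avoidsᵢ k)) ⟩
        is-just (fun f (suc k))                                    ≡⟨ domain f (suc k) ⟩
        A (suc k)                                                  ∎
    ; injective = λ e e′ → suc-injective (injective f (punchedIn e) (punchedIn e′)) }
    where
    open ≡-Reasoning
    avoidsᵢ : ∀ k → fun f (suc k) ≢ just i
    avoidsᵢ k e = 0≢1+n (injective f f₀ e)
    punchedIn : ∀ {k j} → punchOutᴹ i (fun f (suc k)) ≡ just j → fun f (suc k) ≡ just (punchIn i j)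
    punchedIn {k} e = trans (sym (map-punchIn-punchOutᴹ i _ (avoidsᵢ k))) (cong (Maybe.map (punchIn i)) e)

  extend≐⇔≐unextend : ∀ {n} (A₀ : A zero ≡ true) (f : PartialInjection A (suc n)) {i}
    (f₀ : fun f zero ≡ just i) → ∀ g → extend A₀ i g ≐ f ⇔ g ≐ unextend f f₀
  extend≐⇔≐unextend A₀ f {i} f₀ g = mk⇔
    (λ g≐ k → trans (sym (punchOutᴹ-map-punchIn i (fun g k))) (cong (punchOutᴹ i) (g≐ (suc k))))
    (λ { g≐ zero → sym f₀
       ; g≐ (suc k) → trans (cong (Maybe.map (punchIn i)) (g≐ k))
                            (map-punchIn-punchOutᴹ i _ λ e → 0≢1+n (injective f f₀ e)) })

  extend≭ : ∀ {n} (A₀ : A zero ≡ true) (f : PartialInjection A (suc n)) {i j} →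
    fun f zero ≡ just i → j ≢ i → ∀ g → ¬ extend A₀ j g ≐ f
  extend≭ A₀ f f₀ j≢i g g≐ = j≢i (just-injective (trans (g≐ zero) f₀))

  extensions : ∀ b → A zero ≡ b → (∀ n → List (PartialInjection (tail A) n)) →
    ∀ n → List (PartialInjection A n)
  extensions false A₀ gs n       = List.map (skip A₀) (gs n)
  extensions true  A₀ gs zero    = []
  extensions true  A₀ gs (suc n) = concat (tabulate λ i → List.map (extend A₀ i) (gs n))

  length-extensions : ∀ b (A₀ : A zero ≡ b) {gs} c → (∀ n → length (gs n) ≡ n P′ c) →
    ∀ n → length (extensions b A₀ gs n) ≡ n P′ (𝟙 b + c)
  length-extensions false A₀ {gs} c IH n       = trans (length-map (skip A₀) (gs n)) (IH n)
  length-extensions true  A₀      c IH zero    = cong (ℕ._* (0 P′ c)) (sym (ℕₚ.0∸n≡0 c))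
  length-extensions true  A₀ {gs} c IH (suc n) =
    trans (length-concat-tabulate (λ i → List.map (extend A₀ i) (gs n))
                                  (λ i → trans (length-map (extend A₀ i) (gs n)) (IH n)))
          (sym ([1+n]P′[1+k]≡[1+n]*nP′k n c))

  multiplicity-extensions : ∀ b (A₀ : A zero ≡ b) {gs} → (∀ n f → multiplicity (gs n) f ≡ 1) →
    ∀ n f → multiplicity (extensions b A₀ gs n) f ≡ 1
  multiplicity-extensions false A₀ {gs} IH n f =
    trans (multiplicity-map (skip A₀) {f} {unskip f} (gs n) (skip≐⇔≐unskip A₀ f)) (IH n (unskip f))
  multiplicity-extensions true A₀ IH zero f with head-just f A₀
  ... | () , _
  multiplicity-extensions true A₀ {gs} IH (suc n) f with head-just f A₀
  ... | i , f₀ = begin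
    multiplicity (concat (tabulate λ j → List.map (extend A₀ j) (gs n))) f
      ≡⟨ multiplicity-concat-tabulate (λ j → List.map (extend A₀ j) (gs n)) i f
           (λ j j≢i → multiplicity-map-none (extend A₀ j) {f} (gs n) (extend≭ A₀ f f₀ j≢i)) ⟩
    multiplicity (List.map (extend A₀ i) (gs n)) f
      ≡⟨ multiplicity-map (extend A₀ i) {f} {unextend f f₀} (gs n)
           (extend≐⇔≐unextend A₀ f f₀) ⟩
    multiplicity (gs n) (unextend f f₀)
      ≡⟨ IH n (unextend f f₀) ⟩
    1 ∎
    where open ≡-Reasoning

injections : ∀ {K} (A : Fin K → Bool) n → List (PartialInjection A n)
injections {zero}  A n = empty ∷ []
injections {suc K} A   = extensions (A zero) refl (injections (tail A))

length-injections : ∀ {K} (A : Fin K → Bool) n → length (injections A n) ≡ n P′ count A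
length-injections {zero}  A n = refl
length-injections {suc K} A n =
  length-extensions (A zero) refl (count (tail A)) (length-injections (tail A)) n

multiplicity-injections : ∀ {K} (A : Fin K → Bool) n f → multiplicity (injections A n) f ≡ 1
multiplicity-injections {zero}  A n f = refl
multiplicity-injections {suc K} A n f =
  multiplicity-extensions (A zero) refl (multiplicity-injections (tail A)) n f

fallProd≡2^t*nP′t : ∀ n t → fallProd n t ≡ 2 ^ t ℕ.* (n P′ t)
fallProd≡2^t*nP′t n zero    = refl
fallProd≡2^t*nP′t n (suc t) rewrite fallProd≡2^t*nP′t n t | sym (ℕₚ.*-distribˡ-∸ 2 n t) =
  solve 3 (λ p P d → (p :* P) :* (con 2 :* d) := (con 2 :* p) :* (d :* P)) refl (2 ^ t) (n P′ t) (n ∸ t)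
  where open ℕ-Solver.+-*-Solver

nP′k≤n^k : ∀ n k → n P′ k ≤ n ^ k
nP′k≤n^k n zero    = ℕₚ.≤-refl
nP′k≤n^k n (suc k) = ℕₚ.*-mono-≤ (ℕₚ.m∸n≤m n k) (nP′k≤n^k n k)

nP′s≤n^t : ∀ n {s t} → 0 < s → s ≤ t → n P′ s ≤ n ^ t
nP′s≤n^t zero    {suc s} _ _   rewrite ℕₚ.0∸n≡0 s = z≤n
nP′s≤n^t (suc n) {s}     _ s≤t =
  ℕₚ.≤-trans (nP′k≤n^k (suc n) s) (ℕₚ.^-monoʳ-≤ (suc n) s≤t)

frac-0 : ∀ d → frac 0 d ≡ ℚ.0ℚ
frac-0 zero    = refl
frac-0 (suc d) = ℚₚ.0/n≡0 (suc d)

frac-+ : ∀ a b d → frac a d ℚ.+ frac b d ≡ frac (a + b) d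
frac-+ a b zero    = refl
frac-+ a b (suc d) = ℚₚ.toℚᵘ-injective (begin
  ℚ.toℚᵘ (frac a (suc d) ℚ.+ frac b (suc d))
    ≈⟨ ℚₚ.toℚᵘ-homo-+ (frac a (suc d)) (frac b (suc d)) ⟩
  ℚ.toℚᵘ (frac a (suc d)) ℚᵘ.+ ℚ.toℚᵘ (frac b (suc d))
    ≈⟨ ℚᵘₚ.+-cong (ℚₚ.toℚᵘ-fromℚᵘ (mkℚᵘ (ℤ.+ a) d))
                   (ℚₚ.toℚᵘ-fromℚᵘ (mkℚᵘ (ℤ.+ b) d)) ⟩
  mkℚᵘ (ℤ.+ a) d ℚᵘ.+ mkℚᵘ (ℤ.+ b) d
    ≈⟨ *≡* cross ⟩
  mkℚᵘ (ℤ.+ (a + b)) d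
    ≈⟨ ℚᵘₚ.≃-sym (ℚₚ.toℚᵘ-fromℚᵘ (mkℚᵘ (ℤ.+ (a + b)) d)) ⟩
  ℚ.toℚᵘ (frac (a + b) (suc d)) ∎)
  where
  open ℚᵘₚ.≃-Reasoning
  cross : (ℤ.+ a ℤ.* ℤ.+ suc d ℤ.+ ℤ.+ b ℤ.* ℤ.+ suc d) ℤ.* ℤ.+ suc d
        ≡ ℤ.+ (a + b) ℤ.* ℤ.+ (suc d ℕ.* suc d)
  cross rewrite ℤₚ.pos-+ a b | ℤₚ.pos-* (suc d) (suc d) =
    solve 3 (λ x y D → (x :* D :+ y :* D) :* D := (x :+ y) :* (D :* D)) refl
            (ℤ.+ a) (ℤ.+ b) (ℤ.+ suc d)
    where open ℤ-Solver.+-*-Solver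

frac-*-cancelˡ : ∀ {k} a b → 0 < k → frac (k ℕ.* a) (k ℕ.* b) ≡ frac a b
frac-*-cancelˡ {suc k} a zero    _ rewrite ℕₚ.*-zeroʳ k = refl
frac-*-cancelˡ {suc k} a (suc b) _ =
  ℚₚ.fromℚᵘ-cong {mkℚᵘ (ℤ.+ (suc k ℕ.* a)) (b + k ℕ.* suc b)} {mkℚᵘ (ℤ.+ a) b} (*≡* (begin
    ℤ.+ (suc k ℕ.* a) ℤ.* ℤ.+ suc b   ≡⟨ ℤₚ.pos-* (suc k ℕ.* a) (suc b) ⟨
    ℤ.+ (suc k ℕ.* a ℕ.* suc b)       ≡⟨ cong ℤ.+_ (reassociate (suc k) a (suc b)) ⟩
    ℤ.+ (a ℕ.* (suc k ℕ.* suc b))     ≡⟨ ℤₚ.pos-* a (suc k ℕ.* suc b) ⟩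
    ℤ.+ a ℤ.* ℤ.+ (suc k ℕ.* suc b)   ∎))
  where
  open ≡-Reasoning
  reassociate : ∀ k a b → k ℕ.* a ℕ.* b ≡ a ℕ.* (k ℕ.* b)
  reassociate = solve 3 (λ k a b → (k :* a) :* b := a :* (k :* b)) refl
    where open ℕ-Solver.+-*-Solver

fromℕ-nonNeg : ∀ a → ℚ.0ℚ ℚ.≤ fromℕ a
fromℕ-nonNeg a = ℚₚ.nonNegative⁻¹ (fromℕ a) {{ℚₚ.normalize-nonNeg a 1}}

fromℕ-mono-≤ : ∀ {a b} → a ≤ b → fromℕ a ℚ.≤ fromℕ b
fromℕ-mono-≤ {a} {b} a≤b = begin
  fromℕ a                          ≡⟨ ℚₚ.+-identityʳ (fromℕ a) ⟨
  fromℕ a ℚ.+ ℚ.0ℚ                 ≤⟨ ℚₚ.+-monoʳ-≤ (fromℕ a) (fromℕ-nonNeg (b ∸ a)) ⟩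
  fromℕ a ℚ.+ fromℕ (b ∸ a)        ≡⟨ frac-+ a (b ∸ a) 1 ⟩
  fromℕ (a + (b ∸ a))              ≡⟨ cong fromℕ (ℕₚ.m+[n∸m]≡n a≤b) ⟩
  fromℕ b                          ∎
  where open ℚₚ.≤-Reasoning

∣sum-frac-deviation∣≤ : ∀ {X : Set} {d e : ℕ} {τ : ℚ} (c : X → ℕ) xs →
  (∀ x → ℚ.∣ frac (c x) d ℚ.- frac 1 e ∣ ℚ.≤ τ) →
  ℚ.∣ frac (sum (List.map c xs)) d ℚ.- frac (length xs) e ∣ ℚ.≤ fromℕ (length xs) * τ
∣sum-frac-deviation∣≤ {d = d} {e} {τ} c [] _ = begin
  ℚ.∣ frac 0 d ℚ.- frac 0 e ∣   ≡⟨ cong₂ (λ u v → ℚ.∣ u ℚ.- v ∣) (frac-0 d) (frac-0 e) ⟩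
  ℚ.0ℚ                          ≡⟨ ℚₚ.*-zeroˡ τ ⟨
  fromℕ 0 * τ                   ∎
  where open ℚₚ.≤-Reasoning
∣sum-frac-deviation∣≤ {d = d} {e} {τ} c (x ∷ xs) bound = begin
  ℚ.∣ frac (c x + S) d ℚ.- frac (1 + ℓ) e ∣
    ≡⟨ cong₂ (λ u v → ℚ.∣ u ℚ.- v ∣) (frac-+ (c x) S d) (frac-+ 1 ℓ e) ⟨
  ℚ.∣ (frac (c x) d ℚ.+ frac S d) ℚ.- (frac 1 e ℚ.+ frac ℓ e) ∣
    ≡⟨ cong ℚ.∣_∣ (interchange-− (frac (c x) d) (frac S d) (frac 1 e) (frac ℓ e)) ⟩
  ℚ.∣ (frac (c x) d ℚ.- frac 1 e) ℚ.+ (frac S d ℚ.- frac ℓ e) ∣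
    ≤⟨ ℚₚ.∣p+q∣≤∣p∣+∣q∣ (frac (c x) d ℚ.- frac 1 e) (frac S d ℚ.- frac ℓ e) ⟩
  ℚ.∣ frac (c x) d ℚ.- frac 1 e ∣ ℚ.+ ℚ.∣ frac S d ℚ.- frac ℓ e ∣
    ≤⟨ ℚₚ.+-mono-≤ (bound x) (∣sum-frac-deviation∣≤ {d = d} {e} c xs bound) ⟩
  τ ℚ.+ fromℕ ℓ * τ
    ≡⟨ cong (ℚ._+ fromℕ ℓ * τ) (ℚₚ.*-identityˡ τ) ⟨
  fromℕ 1 * τ ℚ.+ fromℕ ℓ * τ
    ≡⟨ ℚₚ.*-distribʳ-+ τ (fromℕ 1) (fromℕ ℓ) ⟨
  (fromℕ 1 ℚ.+ fromℕ ℓ) * τ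
    ≡⟨ cong (_* τ) (frac-+ 1 ℓ 1) ⟩
  fromℕ (1 + ℓ) * τ ∎
  where
  open ℚₚ.≤-Reasoning
  S = sum (List.map c xs)
  ℓ = length xs
  interchange-− : ∀ a b c d → (a ℚ.+ b) ℚ.- (c ℚ.+ d) ≡ (a ℚ.- c) ℚ.+ (b ℚ.- d)
  interchange-− = solve 4 (λ a b c d → (a :+ b) :- (c :+ d) := (a :- c) :+ (b :- d)) refl
    where open ℚ-Solver.+-*-Solver

·-involutiveʳ : ∀ s a → (s · a) · a ≡ s
·-involutiveʳ pos pos = refl
·-involutiveʳ pos neg = refl
·-involutiveʳ neg pos = refl
·-involutiveʳ neg neg = refl

is-just-if : ∀ {X : Set} b (x : X) → is-just (if b then just x else nothing) ≡ b
is-just-if true  x = refl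
is-just-if false x = refl

if≡just : ∀ {X : Set} b {x y : X} → (if b then just x else nothing) ≡ just y → x ≡ y
if≡just true refl = refl

∀-⇔-× : ∀ {I : Set} {P Q R : I → Set} →
  (∀ i → P i ⇔ (Q i × R i)) → (∀ i → P i) ⇔ ((∀ i → Q i) × (∀ i → R i))
∀-⇔-× P⇔Q×R = mk⇔
  (λ P′ → (λ i → proj₁ (to (P⇔Q×R i) (P′ i))) , (λ i → proj₂ (to (P⇔Q×R i) (P′ i))))
  (λ (Q′ , R′) i → from (P⇔Q×R i) (Q′ i , R′ i))
  where open Equivalence

-- The sign σ of the literal σ ψ_i with observed value s is forced: σ ψ_i = s iff σ = s ψ_i.
literal : ∀ {n} → Assignment n → Maybe (Fin n) → Maybe Pm → Maybe (Lit n)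
literal ψ (just i) (just s) = just (i , s · ψ i)
literal ψ (just i) nothing  = nothing
literal ψ nothing  _        = nothing

literal≡just : ∀ {n} ψ (x : Maybe (Fin n)) y {i s} → literal ψ x y ≡ just (i , s) → x ≡ just i
literal≡just ψ (just i) (just s) refl = refl

is-just-literal : ∀ {n} ψ (x : Maybe (Fin n)) y → is-just x ≡ is-just y →
  is-just (literal ψ x y) ≡ is-just y
is-just-literal ψ (just i) (just s) _  = refl
is-just-literal ψ (just i) nothing  ()
is-just-literal ψ nothing  (just s) ()
is-just-literal ψ nothing  nothing  _  = refl

literal-matches⇔ : ∀ {n} ψ (x : Maybe (Fin n)) y (v : Fin n) σ → is-just x ≡ is-just y →
  ((if is-just (literal ψ x y) then just (v , σ) else nothing) ≡ literal ψ x y)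
  ⇔ (((if is-just y then just (σ · ψ v) else nothing) ≡ y)
     × (x ≡ (if is-just y then just v else nothing)))
literal-matches⇔ ψ nothing  nothing  v σ _ = mk⇔ (λ _ → refl , refl) (λ _ → refl)
literal-matches⇔ ψ (just i) (just s) v σ _ = mk⇔
  (λ { refl → cong just (·-involutiveʳ s (ψ i)) , refl })
  (λ { (σψv≡s , refl) →
       cong (λ r → just (v , r))
            (trans (sym (·-involutiveʳ σ (ψ v))) (cong (_· ψ v) (just-injective σψv≡s))) })

observes : ∀ {K} → Star K → (Fin K → Pm) → Bool
observes z x = does (all? λ k → Π (supportZ z) x k ≟Star z k)

matches : ∀ {m n K} → Formula m n K → PartialTuple n K → Fin (suc m) → Bool
matches J P j = does (all? λ k → restrict (supportP P) (J j) k ≟Lit lit P k)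

varsOn : ∀ {n K} (A : Fin K → Bool) → KTuple n K → PartialInjection A n
varsOn A C = record
  { fun       = λ k → if A k then just (var C k) else nothing
  ; domain    = λ k → is-just-if (A k) (var C k)
  ; injective = λ {k} {l} e e′ → var-inj C (trans (if≡just (A k) e) (sym (if≡just (A l) e′))) }

module _ {n K : ℕ} (ψ : Assignment n) (z : Star K) where

  partialTuple : PartialInjection (supportZ z) n → PartialTuple n K
  partialTuple g = record
    { lit     = λ k → literal ψ (fun g k) (z k)
    ; lit-inj = λ { k l i .i s r e e′ refl →
                    injective g (literal≡just ψ (fun g k) (z k) e)
                                (literal≡just ψ (fun g l) (z l) e′) } }

  sizeP-partialTuple : ∀ g → sizeP (partialTuple g) ≡ sizeZ z
  sizeP-partialTuple g = count-cong λ k → is-just-literal ψ (fun g k) (z k) (domain g k)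

module _ {m n K : ℕ} (J : Formula m n K) (ψ : Assignment n) (z : Star K) where

  private
    L = injections (supportZ z) n

  matches-partialTuple : ∀ g j →
    matches J (partialTuple ψ z g) j ≡ observes z (𝒟 J ψ j) ∧ does (g ≐? varsOn (supportZ z) (J j))
  matches-partialTuple g j = does-⇔
    (∀-⇔-× λ k → literal-matches⇔ ψ (fun g k) (z k) (var (J j) k) (sgn (J j) k) (domain g k))
    (all? λ k → restrict (supportP (partialTuple ψ z g)) (J j) k ≟Lit lit (partialTuple ψ z g) k)
    ((all? λ k → Π (supportZ z) (𝒟 J ψ j) k ≟Star z k) ×-dec (g ≐? varsOn (supportZ z) (J j)))

  count-observes :
    count (observes z ∘ 𝒟 J ψ) ≡ sum (List.map (λ g → count (matches J (partialTuple ψ z g))) L)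
  count-observes = count-sum _ _ L λ j → begin
    𝟙 (observes z (𝒟 J ψ j))
      ≡⟨ ℕₚ.*-identityʳ _ ⟨
    𝟙 (observes z (𝒟 J ψ j)) ℕ.* 1
      ≡⟨ cong (𝟙 (observes z (𝒟 J ψ j)) ℕ.*_)
              (multiplicity-injections (supportZ z) n (varsOn (supportZ z) (J j))) ⟨
    𝟙 (observes z (𝒟 J ψ j)) ℕ.* multiplicity L (varsOn (supportZ z) (J j))
      ≡⟨ sum-map-𝟙-∧ (observes z (𝒟 J ψ j)) (λ g → does (g ≐? varsOn (supportZ z) (J j))) L ⟨
    sum (List.map (λ g → 𝟙 (observes z (𝒟 J ψ j) ∧ does (g ≐? varsOn (supportZ z) (J j)))) L)
      ≡⟨ cong sum (map-cong (λ g → cong 𝟙 (matches-partialTuple g j)) L) ⟨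
    sum (List.map (λ g → 𝟙 (matches J (partialTuple ψ z g) j)) L) ∎
    where open ≡-Reasoning

sizeZ≡0⇒Prob≡1 : ∀ {m K} (D : EmpiricalDist m K) z → sizeZ z ≡ 0 → Prob D z ≡ ℚ.1ℚ
sizeZ≡0⇒Prob≡1 {m} D z s≡0 = begin
  frac (count (observes z ∘ D)) (suc m)
    ≡⟨ cong (λ c → frac c (suc m)) all-observed ⟩
  frac (suc m) (suc m)
    ≡⟨ cong₂ frac (ℕₚ.*-identityʳ (suc m)) (ℕₚ.*-identityʳ (suc m)) ⟨
  frac (suc m ℕ.* 1) (suc m ℕ.* 1)
    ≡⟨ frac-*-cancelˡ {suc m} 1 1 (s≤s z≤n) ⟩
  ℚ.1ℚ ∎
  where
  open ≡-Reasoning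
  unobserved : ∀ y v → is-just y ≡ false → (if is-just y then just v else nothing) ≡ y
  unobserved nothing v _ = refl
  all-observed : count (observes z ∘ D) ≡ suc m
  all-observed = begin
    count (observes z ∘ D)
      ≡⟨ count-cong (λ j → dec-true (all? λ k → Π (supportZ z) (D j) k ≟Star z k)
                      λ k → unobserved (z k) (D j k) (count≡0⇒false (supportZ z) s≡0 k)) ⟩
    count {suc m} (λ _ → true)  ≡⟨ count-const (suc m) true ⟩
    suc m ℕ.* 1                 ≡⟨ ℕₚ.*-identityʳ (suc m) ⟩
    suc m                       ∎

PseudoRandom⇒0≤τ : ∀ {m n K t τ} {J : Formula m n K} → PseudoRandom t τ J → ℚ.0ℚ ℚ.≤ τ
PseudoRandom⇒0≤τ {n = n} {K} {τ = τ} pr =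
  ℚₚ.≤-trans (ℚₚ.0≤∣p∣ _) (ℚₚ.<⇒≤ (pr ∅ (ℕₚ.≤-trans (ℕₚ.≤-reflexive size∅≡0) z≤n)))
  where
  ∅ : PartialTuple n K
  ∅ = record { lit = λ _ → nothing ; lit-inj = λ _ _ _ _ _ _ () }
  size∅≡0 : sizeP ∅ ≡ 0
  size∅≡0 = trans (count-const K false) (ℕₚ.*-zeroʳ K)

module _ {m n K t : ℕ} {τ : ℚ} (J : Formula m n K) (pr : PseudoRandom t τ J) (ψ : Assignment n) where

  private
    instance
      τ-nonNeg : ℚ.NonNegative τ
      τ-nonNeg = ℚ.nonNegative (PseudoRandom⇒0≤τ {J = J} pr)

  -- Separate because the general bound (n P′ 0) * τ = τ exceeds n ^ t * τ = 0 when n = 0 < t.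
  close-on-empty-support : ∀ z → sizeZ z ≡ 0 →
    ℚ.∣ Prob (𝒟 J ψ) z ℚ.- frac 1 (2 ^ sizeZ z) ∣ ℚ.≤ fromℕ (n ^ t) * τ
  close-on-empty-support z s≡0 = begin
    ℚ.∣ Prob (𝒟 J ψ) z ℚ.- frac 1 (2 ^ sizeZ z) ∣
      ≡⟨ cong₂ (λ u v → ℚ.∣ u ℚ.- frac 1 (2 ^ v) ∣) (sizeZ≡0⇒Prob≡1 (𝒟 J ψ) z s≡0) s≡0 ⟩
    ℚ.∣ ℚ.1ℚ ℚ.- ℚ.1ℚ ∣   ≡⟨⟩
    ℚ.0ℚ                  ≡⟨ ℚₚ.*-zeroˡ τ ⟨
    ℚ.0ℚ * τ              ≤⟨ ℚₚ.*-monoʳ-≤-nonNeg τ (fromℕ-nonNeg (n ^ t)) ⟩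
    fromℕ (n ^ t) * τ     ∎
    where open ℚₚ.≤-Reasoning

  module _ (z : Star K) (s≤t : sizeZ z ≤ t) where

    private
      A = supportZ z
      s = sizeZ z
      L = injections A n
      N = length L
      c : PartialInjection A n → ℕ
      c g = count (matches J (partialTuple ψ z g))

    Fr-partialTuple-deviation : ∀ g → ℚ.∣ frac (c g) (suc m) ℚ.- frac 1 (fallProd n s) ∣ ℚ.≤ τ
    Fr-partialTuple-deviation g = ℚₚ.<⇒≤
      (subst (λ u → ℚ.∣ Fr J P ℚ.- p n u ∣ ℚ.< τ) (sizeP-partialTuple ψ z g)
             (pr P (subst (_≤ t) (sym (sizeP-partialTuple ψ z g)) s≤t)))
      where P = partialTuple ψ z g

    -- J is nonempty, so some injection exists; this rules out the junk value p n s = frac 1 0 = 0.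
    0<N : 0 < N
    0<N = ℕₚ.≤-trans (ℕₚ.≤-reflexive (sym (multiplicity-injections A n (varsOn A (J zero)))))
                     (multiplicity≤length L (varsOn A (J zero)))

    frac1/2^s≡N/fallProd : frac 1 (2 ^ s) ≡ frac N (fallProd n s)
    frac1/2^s≡N/fallProd = begin
      frac 1 (2 ^ s)                   ≡⟨ frac-*-cancelˡ 1 (2 ^ s) 0<N ⟨
      frac (N ℕ.* 1) (N ℕ.* 2 ^ s)     ≡⟨ cong₂ frac (ℕₚ.*-identityʳ N) (ℕₚ.*-comm N (2 ^ s)) ⟩
      frac N (2 ^ s ℕ.* N)             ≡⟨ cong (λ d → frac N (2 ^ s ℕ.* d)) (length-injections A n) ⟩
      frac N (2 ^ s ℕ.* (n P′ s))      ≡⟨ cong (frac N) (fallProd≡2^t*nP′t n s) ⟨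
      frac N (fallProd n s)            ∎
      where open ≡-Reasoning

    close-on-nonempty-support : 0 < s →
      ℚ.∣ Prob (𝒟 J ψ) z ℚ.- frac 1 (2 ^ s) ∣ ℚ.≤ fromℕ (n ^ t) * τ
    close-on-nonempty-support 0<s = begin
      ℚ.∣ Prob (𝒟 J ψ) z ℚ.- frac 1 (2 ^ s) ∣
        ≡⟨ cong₂ (λ u v → ℚ.∣ u ℚ.- v ∣) (cong (λ k → frac k (suc m)) (count-observes J ψ z))
                                       frac1/2^s≡N/fallProd ⟩
      ℚ.∣ frac (sum (List.map c L)) (suc m) ℚ.- frac N (fallProd n s) ∣
        ≤⟨ ∣sum-frac-deviation∣≤ {d = suc m} {fallProd n s} c L Fr-partialTuple-deviation ⟩
      fromℕ N * τ
        ≤⟨ ℚₚ.*-monoʳ-≤-nonNeg τ (fromℕ-mono-≤ N≤n^t) ⟩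
      fromℕ (n ^ t) * τ ∎
      where
      open ℚₚ.≤-Reasoning
      N≤n^t : N ≤ n ^ t
      N≤n^t = subst (_≤ n ^ t) (sym (length-injections A n)) (nP′s≤n^t n 0<s s≤t)

lemma3 : (m n K t : ℕ) (τ : ℚ) (J : Formula m n K) →
    PseudoRandom t τ J →
    (ψ : Assignment n) → CloseToUniform t (fromℕ (n ^ t) * τ) (𝒟 J ψ)
lemma3 m n K t τ J pr ψ z s≤t with sizeZ z ℕ.≟ 0
... | yes s≡0 = close-on-empty-support J pr ψ z s≡0
... | no  s≢0 = close-on-nonempty-support J pr ψ z s≤t (ℕₚ.n≢0⇒n>0 s≢0)
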